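{- Let $S_1$ and $S_2$ be communicating systems with disjoint role sets $\mathbf{P}_1,\mathbf{P}_2$ such that neither $RS(S_1)$ nor $RS(S_2)$ contains an unspecified reception configuration, and let ${\tt H}\in\mathbf{P}_1$, ${\tt K}\in\mathbf{P}_2$ with $M^1_{\tt H}\leftrightarrow M^2_{\tt K}$. Then $RS(S_1\bowtie_{{\tt H},{\tt K}}S_2)$ contains no unspecified reception configuration.
   Context: A CFSM over finite sets $\mathbf{P}$ of roles and $\mathbb{A}$ of messages is $M=(Q,q_0,\mathbb{A},\delta)$ with $Q$ finite, $q_0\in Q$, $\delta\subseteq Q\times Act\times Q$, $Act=C_\mathbf{P}\times\{!,?\}\times\mathbb{A}$, $C_\mathbf{P}=\{\mathtt{p}\mathtt{q}\mid \mathtt{p},\mathtt{q}\in\mathbf{P},\mathtt{p}\neq\mathtt{q}\}$. Label $\mathtt{s}\mathtt{r}!a$: $\mathtt{s}$ sends $a$ on channel $\mathtt{s}\mathtt{r}$; $\mathtt{s}\mathtt{r}?a$: $\mathtt{r}$ consumes $a$ from $\mathtt{s}\mathtt{r}$. $\mathcal{L}(M)$ is the language of $M$ with all states accepting. A state is final if it has no outgoing transition, sending (resp. receiving) if all outgoing transitions are sending (resp. receiving) actions, mixed otherwise. $M$ is ?-deterministic if for every state $q$, $(q,\mathtt{r}\mathtt{s}?a,q'),(q,\mathtt{p}\mathtt{q}?a,q'')\in\delta$ imply $q'=q''$; !-deterministic analogously; ?!-deterministic if both. A communicating system is $S=(M_\mathtt{p})_{\mathtt{p}\in\mathbf{P}}$,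 $M_\mathtt{p}=(Q_\mathtt{p},q_{0\mathtt{p}},\mathbb{A},\delta_\mathtt{p})$; configurations $(\vec q,\vec w)$ with a local state per role and a FIFO word $w_{\mathtt{p}\mathtt{q}}\in\mathbb{A}^*$ per channel; initial: initial states, empty channels; a send $\mathtt{s}\mathtt{r}!a$ by $\mathtt{s}$ appends $a$ to $w_{\mathtt{s}\mathtt{r}}$, a receive $\mathtt{s}\mathtt{r}?a$ by $\mathtt{r}$ removes $a$ from the front of $w_{\mathtt{s}\mathtt{r}}$, all else unchanged. $RS(S)$: reachable configurations. A configuration $(\vec q,\vec w)$ is an unspecified reception configuration if there is a role $\mathtt{r}$ with $q_\mathtt{r}$ a receiving state such that for every role $\mathtt{s}$ and every $(q_\mathtt{r},\mathtt{s}\mathtt{r}?a,q')\in\delta_\mathtt{r}$ we have $|w_{\mathtt{s}\mathtt{r}}|>0$ and $w_{\mathtt{s}\mathtt{r}}\notin a\mathbb{A}^*$. $M\leftrightarrow M'$ (compatible) if $\mathcal{L}(M)^{\not C}=\overline{\mathcal{L}(M')^{\not C}}$ (channel names erased, $!$ and $?$ swapped), neither has mixed states, both ?!-deterministic. Gateway $\mathrm{gw}(M_{\tt H},{\tt K})$ for $M_{\tt H}=(Q,q_0,\mathbb{A},\delta)$: states $Q\cup\widehat Q$, one fresh state $q^t$ per $t=(q,l,q')\in\delta$; transitions: for $t=(q,{\tt H}\mathtt{s}!a,q')\in\delta$, $(q,{\tt K}{\tt H}?a,q^t),(q^t,{\tt H}\mathtt{s}!a,q')$; for $t=(q,\mathtt{s}{\tt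 H}?a,q')\in\delta$, $(q,\mathtt{s}{\tt H}?a,q^t),(q^t,{\tt H}{\tt K}!a,q')$; initial state $q_0$. Composition: for $S_1=(M^1_\mathtt{p})_{\mathtt{p}\in\mathbf{P}_1}$ over $\mathbf{P}_1,\mathbb{A}_1$ and $S_2=(M^2_\mathtt{p})_{\mathtt{p}\in\mathbf{P}_2}$ over $\mathbf{P}_2,\mathbb{A}_2$ with $\mathbf{P}_1\cap\mathbf{P}_2=\emptyset$ and $M^1_{\tt H}\leftrightarrow M^2_{\tt K}$, $S_1\bowtie_{{\tt H},{\tt K}}S_2=(M_\mathtt{p})_{\mathtt{p}\in\mathbf{P}_1\cup\mathbf{P}_2}$ over $\mathbf{P}_1\cup\mathbf{P}_2$, $\mathbb{A}_1\cup\mathbb{A}_2$, with $M_{\tt H}=\mathrm{gw}(M^1_{\tt H},{\tt K})$, $M_{\tt K}=\mathrm{gw}(M^2_{\tt K},{\tt H})$, $M_\mathtt{p}=M^i_\mathtt{p}$ for the other $\mathtt{p}\in\mathbf{P}_i$. -}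

module Defs where

open import Data.Nat using (ℕ; _+_)
open import Data.Fin using (Fin; _↑ˡ_; _↑ʳ_; _≟_)
open import Data.List using (List; []; _∷_; _∷ʳ_; map; length; lookup; concatMap; allFin)
open import Data.List.Membership.Propositional using (_∈_)
open import Data.Product using (Σ; _×_; _,_; proj₁)
open import Data.Sum using (_⊎_; inj₁; inj₂)
open import Relation.Binary.PropositionalEquality using (_≡_; _≢_)
open import Relation.Nullary using (¬_; yes; no)
open import Function.Bundles using (_⇔_)

-- Actions  pq!a / pq?a   (channel = ordered pair of roles)

data Dir : Set where
  snd rcv : Dir

flipDir : Dir → Dir
flipDir snd = rcv
flipDir rcv = snd

record Act (R A : Set) : Set where
  constructor act
  field
    src : R
    dst : R
    dir : Dir
    msg : A
open Act public

mapAct : ∀ {R R' A : Set} → (R → R') → Act R A → Act R' A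
mapAct f (act s r d a) = act (f s) (f r) d a

record CFSM (R A : Set) : Set where
  field
    nQ : ℕ
    q₀ : Fin nQ
    δ  : List (Fin nQ × Act R A × Fin nQ)
open CFSM public

mapCFSM : ∀ {R R' A : Set} → (R → R') → CFSM R A → CFSM R' A
mapCFSM f M = record
  { nQ = nQ M ; q₀ = q₀ M
  ; δ = map (λ { (q , l , q') → (q , mapAct f l , q') }) (δ M) }

-- runs and language (all states accepting)
data Run {R A : Set} (M : CFSM R A) : Fin (nQ M) → List (Act R A) → Set where
  [] : ∀ {q} → Run M q []
  _∷_ : ∀ {q l q' w} → (q , l , q') ∈ δ M → Run M q' w → Run M q (l ∷ w)

Lang : ∀ {R A : Set} → CFSM R A → List (Act R A) → Set
Lang M w = Run M (q₀ M) w

erase : ∀ {R A : Set} → Act R A → Dir × A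
erase l = dir l , msg l

dualW : ∀ {A : Set} → List (Dir × A) → List (Dir × A)
dualW = map (λ { (d , a) → (flipDir d , a) })

ErasedLang : ∀ {R A : Set} → CFSM R A → List (Dir × A) → Set
ErasedLang M w = Σ _ λ u → Lang M u × map erase u ≡ w

-- all outgoing transitions of q carry direction d (vacuous for final q)
AllOut : ∀ {R A : Set} (M : CFSM R A) → Fin (nQ M) → Dir → Set
AllOut M q d = ∀ {l q'} → (q , l , q') ∈ δ M → dir l ≡ d

NoMixed : ∀ {R A : Set} → CFSM R A → Set
NoMixed M = ∀ q → AllOut M q snd ⊎ AllOut M q rcv

-- ?-deterministic / !-deterministic (same message, arbitrary channels)
DetDir : ∀ {R A : Set} → CFSM R A → Dir → Set
DetDir M d = ∀ {q q' q'' r s p p'} {a} →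
  (q , act r s d a , q') ∈ δ M → (q , act p p' d a , q'') ∈ δ M → q' ≡ q''

Compatible : ∀ {R R' A : Set} → CFSM R A → CFSM R' A → Set
Compatible M M' =
  (∀ w → ErasedLang M w ⇔ ErasedLang M' (dualW w))
  × NoMixed M × NoMixed M'
  × DetDir M rcv × DetDir M snd × DetDir M' rcv × DetDir M' snd

System : Set → Set → Set
System R A = R → CFSM R A

Subject : ∀ {R A : Set} → R → Act R A → Set
Subject p (act s r snd a) = s ≡ p
Subject p (act s r rcv a) = r ≡ p

IsSystem : ∀ {R A : Set} → System R A → Set
IsSystem S = ∀ p {q l q'} → (q , l , q') ∈ δ (S p) → (src l ≢ dst l) × Subject p l

record Config {R A : Set} (S : System R A) : Set where
  field
    states : (p : R) → Fin (nQ (S p))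
    chans  : R → R → List A
open Config public

data Step {R A : Set} (S : System R A) (c c' : Config S) : Set where
  send : ∀ p r a q' →
    (states c p , act p r snd a , q') ∈ δ (S p) →
    states c' p ≡ q' →
    (∀ p' → p' ≢ p → states c' p' ≡ states c p') →
    chans c' p r ≡ chans c p r ∷ʳ a →
    (∀ x y → ¬ (x ≡ p × y ≡ r) → chans c' x y ≡ chans c x y) →
    Step S c c'
  recv : ∀ s p a q' →
    (states c p , act s p rcv a , q') ∈ δ (S p) →
    states c' p ≡ q' →
    (∀ p' → p' ≢ p → states c' p' ≡ states c p') →
    chans c s p ≡ a ∷ chans c' s p →
    (∀ x y → ¬ (x ≡ s × y ≡ p) → chans c' x y ≡ chans c x y) →
    Step S c c'

data Reachable {R A : Set} (S : System R A) : Config S → Set where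
  init : ∀ c → (∀ p → states c p ≡ q₀ (S p)) → (∀ x y → chans c x y ≡ []) →
         Reachable S c
  step : ∀ {c c'} → Reachable S c → Step S c c' → Reachable S c'

-- receiving state: non-final, all outgoing transitions are receptions
Receiving : ∀ {R A : Set} (M : CFSM R A) → Fin (nQ M) → Set
Receiving M q = (Σ _ λ t → t ∈ δ M × proj₁ t ≡ q) × AllOut M q rcv

UnspecRecep : ∀ {R A : Set} (S : System R A) → Config S → Set
UnspecRecep {R} {A} S c = Σ R λ r → Receiving (S r) (states c r) ×
  (∀ s a q' → (states c r , act s r rcv a , q') ∈ δ (S r) →
     Σ A λ b → Σ (List A) λ rest → (chans c s r ≡ b ∷ rest) × (b ≢ a))

NoUnspecRecep : ∀ {R A : Set} → System R A → Set
NoUnspecRecep S = ∀ c → Reachable S c → ¬ UnspecRecep S c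

-- Gateway gw(M_H, K): states Q ∪ Q̂, Q̂ = one fresh state per transition

gwTrans : ∀ {R A : Set} (M : CFSM R A) (h k : R) → Fin (length (δ M)) →
          List (Fin (nQ M + length (δ M)) × Act R A × Fin (nQ M + length (δ M)))
gwTrans M h k i with lookup (δ M) i
... | (q , act s r snd a , q') =
      (old q , act k h rcv a , new) ∷ (new , act s r snd a , old q') ∷ []
  where old = λ x → x ↑ˡ length (δ M) ; new = nQ M ↑ʳ i
... | (q , act s r rcv a , q') =
      (old q , act s r rcv a , new) ∷ (new , act h k snd a , old q') ∷ []
  where old = λ x → x ↑ˡ length (δ M) ; new = nQ M ↑ʳ i

gw : ∀ {R A : Set} → CFSM R A → R → R → CFSM R A
gw M h k = record
  { nQ = nQ M + length (δ M)
  ; q₀ = q₀ M ↑ˡ length (δ M)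
  ; δ  = concatMap (gwTrans M h k) (allFin (length (δ M))) }

compose : ∀ {n₁ n₂} {A : Set} → System (Fin n₁) A → System (Fin n₂) A →
          Fin n₁ → Fin n₂ → System (Fin n₁ ⊎ Fin n₂) A
compose S₁ S₂ H K (inj₁ p) with p ≟ H
... | yes _ = gw (mapCFSM inj₁ (S₁ H)) (inj₁ H) (inj₂ K)
... | no  _ = mapCFSM inj₁ (S₁ p)
compose S₁ S₂ H K (inj₂ p) with p ≟ K
... | yes _ = gw (mapCFSM inj₂ (S₂ K)) (inj₂ K) (inj₁ H)
... | no  _ = mapCFSM inj₂ (S₂ p)

module Submission where

-- Every role of C = S₁ ⋈ S₂ lies on one side, and module Side treats one side
-- (roles running S relabelled, gateway role H facing the other gateway G) once
-- for both.  The argument for a side has three ingredients.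
--  * Projection (project, reach-project): reading every gateway state as the state
--    of M_H it stands for (Pending, gwInfo) and forgetting the other side maps each
--    reachable configuration of C to a reachable one of S, because each step of C
--    is a step of S or leaves the projection unchanged.
--  * Balance (Balanced, inv-reach): along every run of C, M_H and M_K have runs to
--    the states their gateways stand for, and what one received is what the other
--    sent, up to the messages still in transit between them.
--  * Language lemma (next-send): in a ?!-deterministic machine without mixed states,
--    a run that sent strictly more than another, but received no more, continues it
--    by a send.  With compatibility and balance (gateway-accepts), a gateway waiting
--    at a sending state of M_H accepts the message arriving from the other side.
-- So a stuck gateway means a stuck M_H (gateway-stuck), and a stuck role of C gives,
-- via covers and relabelling, a stuck role of S in a reachable configuration.

open import Defs
open import Data.Nat using (ℕ; _+_)
open import Data.Fin using (Fin; _↑ˡ_; _↑ʳ_; splitAt; _≟_)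
open import Data.Fin.Properties using (splitAt-↑ˡ; splitAt-↑ʳ)
open import Data.List using (List; []; _∷_; _∷ʳ_; _++_; map; length; lookup; allFin; [_])
open import Data.List.Properties using (map-++; ++-assoc; ++-identityʳ; ∷-injective; ∷-injectiveˡ)
open import Data.List.Membership.Propositional using (_∈_; find; lose)
open import Data.List.Membership.Propositional.Properties
  using (∈-map⁺; ∈-map⁻; ∈-concatMap⁺; ∈-concatMap⁻; ∈-allFin; ∈-lookup)
open import Data.List.Relation.Unary.Any using (here; there; index)
open import Data.List.Relation.Unary.Any.Properties using (lookup-index)
open import Data.Product using (Σ; _×_; _,_; proj₁; proj₂)
open import Data.Sum using (_⊎_; inj₁; inj₂; [_,_]′) renaming (map to ⊎-map)
open import Data.Sum.Properties using (inj₁-injective; inj₂-injective; ≡-dec)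
open import Data.Empty using (⊥-elim)
open import Function using (id; _∘_)
open import Function.Bundles using (Equivalence; mk⇔; _⇔_)
open import Function.Construct.Symmetry using (⇔-sym)
open import Function.Construct.Composition using (_⇔-∘_)
open import Relation.Binary.PropositionalEquality hiding ([_])
open import Relation.Binary.Definitions using (DecidableEquality)
open import Relation.Nullary using (¬_; Dec; yes; no)

private variable
  R R' P A : Set

trace : List (Act R A) → List (Dir × A)
trace = map erase

messages : Dir → List (Dir × A) → List A
messages d [] = []
messages snd ((snd , a) ∷ w) = a ∷ messages snd w
messages snd ((rcv , a) ∷ w) = messages snd w
messages rcv ((snd , a) ∷ w) = messages rcv w
messages rcv ((rcv , a) ∷ w) = a ∷ messages rcv w

sent received : List (Dir × A) → List A
sent = messages snd
received = messages rcv

messages-++ : ∀ d (u v : List (Dir × A)) → messages d (u ++ v) ≡ messages d u ++ messages d v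
messages-++ d [] v = refl
messages-++ snd ((snd , a) ∷ u) v = cong (a ∷_) (messages-++ snd u v)
messages-++ snd ((rcv , a) ∷ u) v = messages-++ snd u v
messages-++ rcv ((snd , a) ∷ u) v = messages-++ rcv u v
messages-++ rcv ((rcv , a) ∷ u) v = cong (a ∷_) (messages-++ rcv u v)

messages-∷ʳ : ∀ d (u : List (Act R A)) l →
  messages d (trace (u ∷ʳ l)) ≡ messages d (trace u) ++ messages d [ erase l ]
messages-∷ʳ d u l = trans (cong (messages d) (map-++ erase u [ l ])) (messages-++ d (trace u) [ erase l ])

messages-dual : ∀ d (u : List (Dir × A)) → messages d (dualW u) ≡ messages (flipDir d) u
messages-dual d [] = refl
messages-dual snd ((snd , a) ∷ u) = messages-dual snd u
messages-dual snd ((rcv , a) ∷ u) = cong (a ∷_) (messages-dual snd u)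
messages-dual rcv ((snd , a) ∷ u) = cong (a ∷_) (messages-dual rcv u)
messages-dual rcv ((rcv , a) ∷ u) = messages-dual rcv u

dualW-involutive : (u : List (Dir × A)) → dualW (dualW u) ≡ u
dualW-involutive [] = refl
dualW-involutive ((snd , a) ∷ u) = cong ((snd , a) ∷_) (dualW-involutive u)
dualW-involutive ((rcv , a) ∷ u) = cong ((rcv , a) ∷_) (dualW-involutive u)

_≼_ : {X : Set} → List X → List X → Set
u ≼ z = Σ _ λ r → u ++ r ≡ z

≼-∷⁻ : {X : Set} {a b : X} {u z : List X} → (a ∷ u) ≼ (b ∷ z) → a ≡ b × u ≼ z
≼-∷⁻ (r , e) with ∷-injective e
... | a≡b , e' = a≡b , r , e'

data Path (M : CFSM R A) : Fin (nQ M) → List (Act R A) → Fin (nQ M) → Set where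
  [] : ∀ {q} → Path M q [] q
  _∷_ : ∀ {q l q' w q''} → (q , l , q') ∈ δ M → Path M q' w q'' → Path M q (l ∷ w) q''

module _ {M : CFSM R A} where

  path⇒run : ∀ {q u q'} → Path M q u q' → Run M q u
  path⇒run [] = []
  path⇒run (t ∷ π) = t ∷ path⇒run π

  path-∷ʳ : ∀ {q u q' l q''} → Path M q u q' → (q' , l , q'') ∈ δ M → Path M q (u ∷ʳ l) q''
  path-∷ʳ [] t = t ∷ []
  path-∷ʳ (t' ∷ π) t = t' ∷ path-∷ʳ π t

  same-dir : NoMixed M → ∀ {q l l' q' q''} → (q , l , q') ∈ δ M → (q , l' , q'') ∈ δ M → dir l ≡ dir l'
  same-dir nm {q} t t' with nm q
  ... | inj₁ sending = trans (sending t) (sym (sending t'))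
  ... | inj₂ receiving = trans (receiving t) (sym (receiving t'))

  -- Then z can only have followed x
  -- up to q₁ and taken a transition sending b there: such a transition exists.
  next-send : NoMixed M → DetDir M rcv → DetDir M snd →
    ∀ {q x q₁ z b T} → Path M q x q₁ → Run M q z →
    sent (trace z) ≡ sent (trace x) ++ b ∷ T → received (trace z) ≼ received (trace x) →
    AllOut M q₁ snd → Σ _ λ s → Σ _ λ r → Σ _ λ q' → (q₁ , act s r snd b , q') ∈ δ M
  next-send nm dr ds [] (_∷_ {l = act s r d a} t z) es hr q₁-sends with q₁-sends t
  ... | refl with ∷-injective es
  ...   | refl , _ = s , r , _ , t
  next-send nm dr ds (_∷_ {l = l} {w = x} t π) [] es hr q₁-sends = ⊥-elim ([]≢++∷ (sent (trace (l ∷ x))) es)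
    where
    []≢++∷ : ∀ {X : Set} (U : List X) {b V} → [] ≢ U ++ b ∷ V
    []≢++∷ [] ()
    []≢++∷ (_ ∷ _) ()
  next-send nm dr ds (_∷_ {l = act _ _ snd a} t x) (_∷_ {l = act _ _ snd a'} t' z) es hr q₁-sends
    with ∷-injective es
  ... | refl , es' with ds t t'
  ... | refl = next-send nm dr ds x z es' hr q₁-sends
  next-send nm dr ds (_∷_ {l = act _ _ rcv a} t x) (_∷_ {l = act _ _ rcv a'} t' z) es hr q₁-sends
    with ≼-∷⁻ hr
  ... | refl , hr' with dr t t'
  ... | refl = next-send nm dr ds x z es hr' q₁-sends
  next-send nm dr ds (_∷_ {l = act _ _ snd _} t x) (_∷_ {l = act _ _ rcv _} t' z) es hr q₁-sends
    with same-dir nm t t'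
  ... | ()
  next-send nm dr ds (_∷_ {l = act _ _ rcv _} t x) (_∷_ {l = act _ _ snd _} t' z) es hr q₁-sends
    with same-dir nm t t'
  ... | ()

module _ (f : R → R') {M : CFSM R A} where

  unmap : ∀ {x l y} → (x , l , y) ∈ δ (mapCFSM f M) →
    Σ _ λ l₀ → (x , l₀ , y) ∈ δ M × l ≡ mapAct f l₀
  unmap t with ∈-map⁻ _ t
  ... | (_ , l₀ , _) , t₀ , refl = l₀ , t₀ , refl

  remap : ∀ {x l₀ y} → (x , l₀ , y) ∈ δ M → (x , mapAct f l₀ , y) ∈ δ (mapCFSM f M)
  remap = ∈-map⁺ _

  unmap-act : ∀ {x s r d a y} → (x , act s r d a , y) ∈ δ (mapCFSM f M) →
    Σ _ λ s₀ → Σ _ λ r₀ → s ≡ f s₀ × r ≡ f r₀ × (x , act s₀ r₀ d a , y) ∈ δ M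
  unmap-act t with unmap t
  ... | act s₀ r₀ _ _ , t₀ , refl = s₀ , r₀ , refl , refl , t₀

  erase-mapAct : (l : Act R A) → erase (mapAct f l) ≡ erase l
  erase-mapAct (act s r d a) = refl

  ErasedLang-map : ∀ w → ErasedLang (mapCFSM f M) w ⇔ ErasedLang M w
  ErasedLang-map w = mk⇔ from-mapped to-mapped
    where
    run-map : ∀ {q u} → Run M q u → Run (mapCFSM f M) q (map (mapAct f) u)
    run-map [] = []
    run-map (t ∷ ρ) = remap t ∷ run-map ρ

    run-unmap : ∀ {q u} → Run (mapCFSM f M) q u → Σ _ λ u₀ → Run M q u₀ × trace u₀ ≡ trace u
    run-unmap [] = [] , [] , refl
    run-unmap (t ∷ ρ) with unmap t | run-unmap ρ
    ... | l₀ , t₀ , refl | u₀ , ρ₀ , e = l₀ ∷ u₀ , t₀ ∷ ρ₀ , cong₂ _∷_ (sym (erase-mapAct l₀)) e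

    trace-map : (u : List (Act R A)) → trace (map (mapAct f) u) ≡ trace u
    trace-map [] = refl
    trace-map (l ∷ u) = cong₂ _∷_ (erase-mapAct l) (trace-map u)

    from-mapped : ErasedLang (mapCFSM f M) w → ErasedLang M w
    from-mapped (u , ρ , e) with run-unmap ρ
    ... | u₀ , ρ₀ , e₀ = u₀ , ρ₀ , trans e₀ e

    to-mapped : ErasedLang M w → ErasedLang (mapCFSM f M) w
    to-mapped (u , ρ , e) = map (mapAct f) u , run-map ρ , trans (trace-map u) e

  AllOut-map : ∀ {q d} → AllOut M q d → AllOut (mapCFSM f M) q d
  AllOut-map out t with unmap t
  ... | act _ _ _ _ , t₀ , refl = out t₀

  NoMixed-map : NoMixed M → NoMixed (mapCFSM f M)
  NoMixed-map nm q = ⊎-map AllOut-map AllOut-map (nm q)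

  DetDir-map : ∀ d → DetDir M d → DetDir (mapCFSM f M) d
  DetDir-map d det t t' with unmap t | unmap t'
  ... | act _ _ _ _ , t₀ , refl | act _ _ _ _ , t₀' , refl = det t₀ t₀'

Compatible-map : ∀ {R₁ R₁' : Set} (f : R → R₁) (g : R' → R₁') {M : CFSM R A} {M' : CFSM R' A} →
  Compatible M M' → Compatible (mapCFSM f M) (mapCFSM g M')
Compatible-map f g {M} {M'} (lang , nm , nm' , dr , ds , dr' , ds') =
  (λ w → ⇔-sym (ErasedLang-map g (dualW w)) ⇔-∘ (lang w ⇔-∘ ErasedLang-map f w)) ,
  NoMixed-map f {M} nm , NoMixed-map g {M'} nm' ,
  DetDir-map f {M} rcv dr , DetDir-map f {M} snd ds , DetDir-map g {M'} rcv dr' , DetDir-map g {M'} snd ds'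

Compatible-sym : {M : CFSM R A} {M' : CFSM R' A} → Compatible M M' → Compatible M' M
Compatible-sym {M = M} {M'} (lang , nm , nm' , dr , ds , dr' , ds') =
  (λ w → subst (λ v → ErasedLang M' v ⇔ ErasedLang M (dualW w)) (dualW-involutive w) (⇔-sym (lang (dualW w)))) ,
  nm' , nm , dr' , ds' , dr , ds

-- What a state of gw(M, ·) records about M: the state of M it stands for, and the
-- message it holds half-way through a transition of M (fetched from the opposite
-- gateway for a send of M, resp. received for M and not yet forwarded).
record Pending (M : CFSM R A) : Set where
  constructor pending
  field
    origin : Fin (nQ M)
    toSend : List A
    toForward : List A
open Pending public

module _ (M : CFSM R A) where
  private
    L : ℕ
    L = length (δ M)

  old : Fin (nQ M) → Fin (nQ M + L)
  old q = q ↑ˡ L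

  new : Fin L → Fin (nQ M + L)
  new i = nQ M ↑ʳ i

  -- the fresh state q^t is half-way through t
  midway : Fin (nQ M) × Act R A × Fin (nQ M) → Pending M
  midway (q , act _ _ snd a , q') = pending q [ a ] []
  midway (q , act _ _ rcv a , q') = pending q' [] [ a ]

  gwInfo : Fin (nQ M + L) → Pending M
  gwInfo x = [ (λ q → pending q [] []) , (λ i → midway (lookup (δ M) i)) ]′ (splitAt (nQ M) x)

  gwInfo-old : ∀ {x q} → x ≡ old q → gwInfo x ≡ pending q [] []
  gwInfo-old {q = q} refl = cong [ _ , _ ]′ (splitAt-↑ˡ (nQ M) q L)

  gwInfo-new : ∀ {i t} → lookup (δ M) i ≡ t → gwInfo (new i) ≡ midway t
  gwInfo-new {i} eq = trans (cong [ _ , _ ]′ (splitAt-↑ʳ (nQ M) L i)) (cong midway eq)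

  module _ (h k : R) where

    data GwStep (x y : Fin (nQ (gw M h k))) : Act R A → Set where
      fetch : ∀ {q s r a q'} → (q , act s r snd a , q') ∈ δ M → x ≡ old q →
              gwInfo y ≡ pending q [ a ] [] → GwStep x y (act k h rcv a)
      emit : ∀ {q s r a q'} → (q , act s r snd a , q') ∈ δ M → gwInfo x ≡ pending q [ a ] [] →
             y ≡ old q' → GwStep x y (act s r snd a)
      take : ∀ {q s r a q'} → (q , act s r rcv a , q') ∈ δ M → x ≡ old q →
             gwInfo y ≡ pending q' [] [ a ] → GwStep x y (act s r rcv a)
      forward : ∀ {q a} → gwInfo x ≡ pending q [] [ a ] → y ≡ old q → GwStep x y (act h k snd a)

    classify : ∀ {x l y} → (x , l , y) ∈ δ (gw M h k) → GwStep x y l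
    classify t with find (∈-concatMap⁻ (gwTrans M h k) {xs = allFin L} t)
    ... | i , _ , t' = by-index i t'
      where
      lookup∈ : ∀ {i t} → lookup (δ M) i ≡ t → t ∈ δ M
      lookup∈ {i} refl = ∈-lookup i
      by-index : ∀ i {x l y} → (x , l , y) ∈ gwTrans M h k i → GwStep x y l
      by-index i t with lookup (δ M) i in eq
      by-index i (here refl) | (q , act s r snd a , q') = fetch (lookup∈ eq) refl (gwInfo-new eq)
      by-index i (there (here refl)) | (q , act s r snd a , q') = emit (lookup∈ eq) (gwInfo-new eq) refl
      by-index i (here refl) | (q , act s r rcv a , q') = take (lookup∈ eq) refl (gwInfo-new eq)
      by-index i (there (here refl)) | (q , act s r rcv a , q') = forward (gwInfo-new eq) refl

    private
      in-gw : ∀ i {t} → t ∈ gwTrans M h k i → t ∈ δ (gw M h k)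
      in-gw i m = ∈-concatMap⁺ (gwTrans M h k) (lose (∈-allFin i) m)

    gw-fetch : ∀ {q s r a q'} → (q , act s r snd a , q') ∈ δ M →
               Σ _ λ y → (old q , act k h rcv a , y) ∈ δ (gw M h k)
    gw-fetch t = new (index t) , in-gw (index t) (first-half (sym (lookup-index t)))
      where
      first-half : ∀ {i q s r a q'} → lookup (δ M) i ≡ (q , act s r snd a , q') →
                   (old q , act k h rcv a , new i) ∈ gwTrans M h k i
      first-half eq rewrite eq = here refl

    gw-take : ∀ {q s r a q'} → (q , act s r rcv a , q') ∈ δ M →
              Σ _ λ y → (old q , act s r rcv a , y) ∈ δ (gw M h k)
    gw-take t = new (index t) , in-gw (index t) (first-half (sym (lookup-index t)))
      where
      first-half : ∀ {i q s r a q'} → lookup (δ M) i ≡ (q , act s r rcv a , q') →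
                   (old q , act s r rcv a , new i) ∈ gwTrans M h k i
      first-half eq rewrite eq = here refl

-- Two gateways wrapping M and M', in situation ξ resp. η, with channel v from the
-- first gateway to the second and w back, are balanced when M and M' can have run
-- to the states the gateways stand for so that every message received by M was
-- either sent by M' or is still in transit towards it (in the gateway of M, on v,
-- or in the gateway of M'), and symmetrically.
record Balanced (M : CFSM R A) (M' : CFSM R' A) (ξ : Pending M) (η : Pending M') (v w : List A) : Set where
  constructor balanced
  field
    run : List (Act R A)
    run' : List (Act R' A)
    path : Path M (q₀ M) run (origin ξ)
    path' : Path M' (q₀ M') run' (origin η)
    flow : received (trace run) ≡ sent (trace run') ++ toSend η ++ v ++ toForward ξ
    flow' : received (trace run') ≡ sent (trace run) ++ toSend ξ ++ w ++ toForward η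

module _ {M : CFSM R A} {M' : CFSM R' A} where

  balanced-start : Balanced M M' (pending (q₀ M) [] []) (pending (q₀ M') [] []) [] []
  balanced-start = balanced [] [] [] [] refl refl

  balanced-swap : ∀ {ξ η v w} → Balanced M M' ξ η v w → Balanced M' M η ξ w v
  balanced-swap (balanced u u' π π' f f') = balanced u' u π' π f' f

  -- The gateway of M fetches the message a that M is about to send: a moves from w
  -- into the gateway, leaving both flows unchanged.
  balanced-fetch : ∀ {q a η v w} →
    Balanced M M' (pending q [] []) η v (a ∷ w) → Balanced M M' (pending q [ a ] []) η v w
  balanced-fetch (balanced u u' π π' f f') = balanced u u' π π' f f'

  balanced-emit : ∀ {q s r a q' η v w} → (q , act s r snd a , q') ∈ δ M →
    Balanced M M' (pending q [ a ] []) η v w → Balanced M M' (pending q' [] []) η v w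
  balanced-emit {s = s} {r} {a} {η = η} {v} {w} t (balanced u u' π π' f f') =
    balanced (u ∷ʳ l) u' (path-∷ʳ π t) π' flow₁ flow₁'
    where
    l : Act R A
    l = act s r snd a
    flow₁ : received (trace (u ∷ʳ l)) ≡ sent (trace u') ++ toSend η ++ v ++ []
    flow₁ = trans (messages-∷ʳ rcv u l) (trans (++-identityʳ _) f)
    flow₁' : received (trace u') ≡ sent (trace (u ∷ʳ l)) ++ [] ++ w ++ toForward η
    flow₁' = begin
      received (trace u')                             ≡⟨ f' ⟩
      sent (trace u) ++ a ∷ w ++ toForward η          ≡⟨ ++-assoc (sent (trace u)) [ a ] _ ⟨
      (sent (trace u) ++ [ a ]) ++ w ++ toForward η   ≡⟨ cong (_++ w ++ toForward η) (messages-∷ʳ snd u l) ⟨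
      sent (trace (u ∷ʳ l)) ++ w ++ toForward η       ∎
      where open ≡-Reasoning

  balanced-take : ∀ {q s r a q' η v w} → (q , act s r rcv a , q') ∈ δ M →
    Balanced M M' (pending q [] []) η v w → Balanced M M' (pending q' [] [ a ]) η v w
  balanced-take {s = s} {r} {a} {η = η} {v} {w} t (balanced u u' π π' f f') =
    balanced (u ∷ʳ l) u' (path-∷ʳ π t) π' flow₁ flow₁'
    where
    l : Act R A
    l = act s r rcv a
    flow₁ : received (trace (u ∷ʳ l)) ≡ sent (trace u') ++ toSend η ++ v ++ [ a ]
    flow₁ = begin
      received (trace (u ∷ʳ l))                          ≡⟨ messages-∷ʳ rcv u l ⟩
      received (trace u) ++ [ a ]                        ≡⟨ cong (_++ [ a ]) f ⟩
      (sent (trace u') ++ toSend η ++ v ++ []) ++ [ a ]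
        ≡⟨ cong (λ z → (sent (trace u') ++ toSend η ++ z) ++ [ a ]) (++-identityʳ v) ⟩
      (sent (trace u') ++ toSend η ++ v) ++ [ a ]        ≡⟨ ++-assoc (sent (trace u')) _ [ a ] ⟩
      sent (trace u') ++ (toSend η ++ v) ++ [ a ]        ≡⟨ cong (sent (trace u') ++_) (++-assoc (toSend η) v [ a ]) ⟩
      sent (trace u') ++ toSend η ++ v ++ [ a ]          ∎
      where open ≡-Reasoning
    flow₁' : received (trace u') ≡ sent (trace (u ∷ʳ l)) ++ [] ++ w ++ toForward η
    flow₁' = trans f' (cong (_++ w ++ toForward η) (sym (trans (messages-∷ʳ snd u l) (++-identityʳ _))))

  balanced-forward : ∀ {q a η v w} →
    Balanced M M' (pending q [] [ a ]) η v w → Balanced M M' (pending q [] []) η (v ∷ʳ a) w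
  balanced-forward {a = a} {η} {v} (balanced u u' π π' f f') =
    balanced u u' π π' (trans f (cong (λ z → sent (trace u') ++ toSend η ++ z) (sym (++-identityʳ (v ∷ʳ a))))) f'

  -- This is where compatibility is used:
  -- the dual of the run of M' is a run z of M, and the language lemma applies to
  -- the run of M and z.
  balanced-next-send : Compatible M M' → ∀ {q b η v w} →
    Balanced M M' (pending q [] []) η v (b ∷ w) → AllOut M q snd →
    Σ _ λ s → Σ _ λ r → Σ _ λ q' → (q , act s r snd b , q') ∈ δ M
  balanced-next-send (lang , nm , _ , dr , ds , _ , _) {η = η} {v} {w} (balanced u u' π π' f f') q-sends
    with Equivalence.from (lang (dualW (trace u'))) (u' , path⇒run π' , sym (dualW-involutive (trace u')))
  ... | z , ρ , z-dual = next-send nm dr ds π ρ sent-z (toSend η ++ v ++ [] , received-z) q-sends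
    where
    sent-z : sent (trace z) ≡ sent (trace u) ++ _ ∷ w ++ toForward η
    sent-z = trans (cong sent z-dual) (trans (messages-dual snd (trace u')) f')
    received-z : received (trace z) ++ toSend η ++ v ++ [] ≡ received (trace u)
    received-z = trans (cong (λ y → received y ++ _) z-dual)
                   (trans (cong (_++ _) (messages-dual rcv (trace u'))) (sym f))

Balanced-cong : {M : CFSM R A} {M' : CFSM R' A} → ∀ {ξ ξ' η η' v v' w w'} →
  ξ ≡ ξ' → η ≡ η' → v ≡ v' → w ≡ w' → Balanced M M' ξ η v w → Balanced M M' ξ' η' v' w'
Balanced-cong refl refl refl refl β = β

record Cover (N M : CFSM R A) : Set where
  field
    cover : Fin (nQ N) → Fin (nQ M)
    cover-q₀ : cover (q₀ N) ≡ q₀ M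
    preserve : ∀ {x l y} → (x , l , y) ∈ δ N → (cover x , l , cover y) ∈ δ M
    reflect : ∀ {x l y} → (cover x , l , y) ∈ δ M → Σ _ λ y' → (x , l , y') ∈ δ N
open Cover public

cover-id : {M : CFSM R A} → Cover M M
cover-id = record { cover = id ; cover-q₀ = refl ; preserve = id ; reflect = λ t → _ , t }

Stuck : (M : CFSM R A) → R → Fin (nQ M) → (R → List A) → Set
Stuck {R} {A} M r q ch = Receiving M q ×
  (∀ s a q' → (q , act s r rcv a , q') ∈ δ M → Σ A λ b → Σ (List A) λ rest → (ch s ≡ b ∷ rest) × (b ≢ a))

stuck-cover : {N M : CFSM R A} (C : Cover N M) → ∀ {r x ch} → Stuck N r x ch → Stuck M r (cover C x) ch
stuck-cover C ((((_ , l , y) , t , refl) , receiving) , blocked) =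
  (((cover C _ , l , cover C y) , preserve C t , refl) , λ t' → receiving (proj₂ (reflect C t'))) ,
  λ s a q' t' → blocked s a _ (proj₂ (reflect C t'))

stuck-unmap : (f : P → R) {M : CFSM P A} → ∀ {p q ch} → Stuck (mapCFSM f M) (f p) q ch → Stuck M p q (ch ∘ f)
stuck-unmap f {M} ((((_ , l , y) , t , refl) , receiving) , blocked) with unmap f {M} t
... | l₀ , t₀ , refl =
  (((_ , l₀ , y) , t₀ , refl) , λ { {act _ _ _ _} t' → receiving (remap f {M} t') }) ,
  λ s a q' t' → blocked (f s) a q' (remap f {M} t')

module _ {M : CFSM R A} (nm : NoMixed M) where

  sending-state : ∀ {q s r a q'} → (q , act s r snd a , q') ∈ δ M → AllOut M q snd
  sending-state {q} t with nm q
  ... | inj₁ sending = sending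
  ... | inj₂ receiving with receiving t
  ...   | ()

  receiving-state : ∀ {q s r a q'} → (q , act s r rcv a , q') ∈ δ M → AllOut M q rcv
  receiving-state {q} t with nm q
  ... | inj₂ receiving = receiving
  ... | inj₁ sending with sending t
  ...   | ()

gateway-accepts : {M M' : CFSM R A} → Compatible M M' → ∀ {h k q b η v w} →
  Balanced M M' (pending q [] []) η v (b ∷ w) → AllOut M q snd →
  Σ _ λ y → (old M q , act k h rcv b , y) ∈ δ (gw M h k)
gateway-accepts {M = M} compat {h} {k} β q-sends with balanced-next-send compat β q-sends
... | _ , _ , _ , t = gw-fetch M h k t

-- Its witness transition is a
-- reception, so the gateway sits at a state old q; if q is a receiving state of M,
-- the gateway offers exactly the receptions of M at q; if q is sending, the gateway
-- cannot be stuck, by gateway-accepts.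
gateway-stuck : {M M' : CFSM R A} → Compatible M M' → ∀ {h k x ch η v} →
  Stuck (gw M h k) h x ch → Balanced M M' (gwInfo M x) η v (ch k) → Stuck M h (origin (gwInfo M x)) ch
gateway-stuck {M = M} compat {h} {k} ((((_ , _ , _) , t , refl) , receiving) , blocked) β
  with classify M h k t
... | emit _ _ _ with receiving t
...   | ()
gateway-stuck _ ((((_ , _ , _) , t , refl) , receiving) , _) _ | forward _ _ with receiving t
...   | ()
gateway-stuck {M = M} (_ , nm , _) {h} {k} ((((_ , _ , _) , t , refl) , _) , blocked) _
  | take {q} tM refl _ rewrite gwInfo-old M {old M q} refl =
  ((_ , tM , refl) , receiving-state {M = M} nm tM) ,
  λ s a q' t' → blocked s a _ (proj₂ (gw-take M h k t'))
gateway-stuck {M = M} compat@(_ , nm , _) {h} {k} ((((_ , _ , _) , t , refl) , _) , blocked) β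
  | fetch {q} {a = a} tM refl _ with blocked k a _ t
... | b , _ , ch≡b∷_ , _ = ⊥-elim (accepted (gateway-accepts compat β' (sending-state {M = M} nm tM)))
  where
  β' : Balanced M _ (pending q [] []) _ _ (b ∷ _)
  β' = subst₂ (λ ξ w → Balanced M _ ξ _ _ w) (gwInfo-old M refl) ch≡b∷_ β
  accepted : ¬ Σ _ λ y → (old M q , act k h rcv b , y) ∈ δ (gw M h k)
  accepted (_ , t-b) with blocked k b _ t-b
  ... | b' , _ , ch≡b'∷_ , b'≢b = b'≢b (∷-injectiveˡ (trans (sym ch≡b'∷_) ch≡b∷_))

_≈_ : {S : System R A} → Config S → Config S → Set
c ≈ c' = (∀ p → states c p ≡ states c' p) × (∀ x y → chans c x y ≡ chans c' x y)

Reachable-resp : {S : System R A} → ∀ {c c'} → Reachable S c → c ≈ c' → Reachable S c'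
Reachable-resp (init c at-q₀ empty) (same , same-ch) =
  init _ (λ p → trans (sym (same p)) (at-q₀ p)) (λ x y → trans (sym (same-ch x y)) (empty x y))
Reachable-resp (step ρ (send p r a q' t e fr ch chfr)) (same , same-ch) =
  step ρ (send p r a q' t (trans (sym (same p)) e) (λ p' ne → trans (sym (same p')) (fr p' ne))
                (trans (sym (same-ch p r)) ch) (λ x y ne → trans (sym (same-ch x y)) (chfr x y ne)))
Reachable-resp (step ρ (recv s p a q' t e fr ch chfr)) (same , same-ch) =
  step ρ (recv s p a q' t (trans (sym (same p)) e) (λ p' ne → trans (sym (same p')) (fr p' ne))
                (trans ch (cong (a ∷_) (same-ch s p))) (λ x y ne → trans (sym (same-ch x y)) (chfr x y ne)))

module GatewayRole {R A : Set} (C : System R A) {h k : R} (h≢k : h ≢ k)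
  {M : CFSM R A} (gate : Cover (C h) (gw M h k))
  (avoids : ∀ {x l y} → (x , l , y) ∈ δ M → src l ≢ k × dst l ≢ k) where

  BalancedAt : {R' : Set} (M' : CFSM R' A) → Config C → Pending M' → Set
  BalancedAt M' c η = Balanced M M' (gwInfo M (cover gate (states c h))) η (chans c h k) (chans c k h)

  -- The steps of h are the gateway steps classified by GwStep; M's own sends and
  -- receptions use channels other than those between h and k.
  send-by-gateway : ∀ {R'} {M' : CFSM R' A} {c c' : Config C} {r a η} →
    (states c h , act h r snd a , states c' h) ∈ δ (C h) →
    chans c' h r ≡ chans c h r ∷ʳ a → (∀ x y → ¬ (x ≡ h × y ≡ r) → chans c' x y ≡ chans c x y) →
    BalancedAt M' c η → BalancedAt M' c' η
  send-by-gateway t ch chfr β with classify M h k (preserve gate t)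
  ... | emit tM at-x at-y =
    Balanced-cong (sym (gwInfo-old M at-y)) refl
      (sym (chfr _ _ λ { (_ , k≡r) → proj₂ (avoids tM) (sym k≡r) }))
      (sym (chfr _ _ λ { (k≡h , _) → h≢k (sym k≡h) }))
      (balanced-emit tM (Balanced-cong at-x refl refl refl β))
  ... | forward at-x at-y =
    Balanced-cong (sym (gwInfo-old M at-y)) refl (sym ch) (sym (chfr _ _ λ { (k≡h , _) → h≢k (sym k≡h) }))
      (balanced-forward (Balanced-cong at-x refl refl refl β))

  recv-by-gateway : ∀ {R'} {M' : CFSM R' A} {c c' : Config C} {s a η} →
    (states c h , act s h rcv a , states c' h) ∈ δ (C h) →
    chans c s h ≡ a ∷ chans c' s h → (∀ x y → ¬ (x ≡ s × y ≡ h) → chans c' x y ≡ chans c x y) →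
    BalancedAt M' c η → BalancedAt M' c' η
  recv-by-gateway t ch chfr β with classify M h k (preserve gate t)
  ... | fetch tM at-x at-y =
    Balanced-cong (sym at-y) refl (sym (chfr _ _ λ { (h≡k , _) → h≢k h≡k })) refl
      (balanced-fetch (Balanced-cong (gwInfo-old M at-x) refl refl ch β))
  ... | take tM at-x at-y =
    Balanced-cong (sym at-y) refl
      (sym (chfr _ _ λ { (_ , k≡h) → h≢k (sym k≡h) }))
      (sym (chfr _ _ λ { (k≡s , _) → proj₁ (avoids tM) (sym k≡s) }))
      (balanced-take tM (Balanced-cong (gwInfo-old M at-x) refl refl refl β))

-- Nothing is assumed about the remaining roles of C.
module Side {P Q R A : Set} (C : System R A)
  (ι : P → R) (κ : Q → R) (ι-injective : ∀ {p p'} → ι p ≡ ι p' → p ≡ p')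
  (ι≢κ : ∀ p q → ι p ≢ κ q) (image : ∀ r → (Σ P λ p → r ≡ ι p) ⊎ (∀ p → ι p ≢ r))
  (_≟ᴾ_ : DecidableEquality P) (_≟ᴿ_ : DecidableEquality R)
  (S : System P A) (H : P) (M' : CFSM Q A) (K : Q)
  (local : ∀ p → p ≢ H → Cover (C (ι p)) (mapCFSM ι (S p)))
  (gateH : Cover (C (ι H)) (gw (mapCFSM ι (S H)) (ι H) (κ K)))
  (gateK : Cover (C (κ K)) (gw (mapCFSM κ M') (κ K) (ι H)))
  where

  G : R
  G = κ K

  MH : CFSM R A
  MH = mapCFSM ι (S H)

  MK : CFSM R A
  MK = mapCFSM κ M'

  localState : (p : P) → Dec (p ≡ H) → Fin (nQ (C (ι p))) → Fin (nQ (S p))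
  localState p (yes refl) x = origin (gwInfo MH (cover gateH x))
  localState p (no p≢H) x = cover (local p p≢H) x

  project : Config C → Config S
  project c = record
    { states = λ p → localState p (p ≟ᴾ H) (states c (ι p))
    ; chans = λ x y → chans c (ι x) (ι y) }

  private
    origin-old : ∀ {y q} → y ≡ old MH q → origin (gwInfo MH y) ≡ q
    origin-old e = cong origin (gwInfo-old MH e)

  local-initial : ∀ p (d : Dec (p ≡ H)) {x} → x ≡ q₀ (C (ι p)) → localState p d x ≡ q₀ (S p)
  local-initial p (yes refl) refl = origin-old (cover-q₀ gateH)
  local-initial p (no p≢H) refl = cover-q₀ (local p p≢H)

  local-send : ∀ p (d : Dec (p ≡ H)) {x y r a} → (x , act (ι p) r snd a , y) ∈ δ (C (ι p)) →
    (Σ P λ r₀ → r ≡ ι r₀ × (localState p d x , act p r₀ snd a , localState p d y) ∈ δ (S p))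
    ⊎ (r ≡ G × localState p d x ≡ localState p d y)
  local-send p (no p≢H) t with unmap-act ι {S p} (preserve (local p p≢H) t)
  ... | _ , r₀ , ιp≡ιs₀ , refl , t₀ with ι-injective ιp≡ιs₀
  ...   | refl = inj₁ (r₀ , refl , t₀)
  local-send p (yes refl) t with classify MH (ι H) G (preserve gateH t)
  ... | forward at-x at-y = inj₂ (refl , trans (cong origin at-x) (sym (origin-old at-y)))
  ... | emit tM at-x at-y with unmap-act ι {S H} tM
  ...   | _ , r₀ , ιH≡ιs₀ , refl , t₀ with ι-injective ιH≡ιs₀
  ...     | refl = inj₁ (r₀ , refl , subst₂ (λ q q' → (q , _ , q') ∈ δ (S H))
                                             (sym (cong origin at-x)) (sym (origin-old at-y)) t₀)

  local-recv : ∀ p (d : Dec (p ≡ H)) {x y s a} → (x , act s (ι p) rcv a , y) ∈ δ (C (ι p)) →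
    (Σ P λ s₀ → s ≡ ι s₀ × (localState p d x , act s₀ p rcv a , localState p d y) ∈ δ (S p))
    ⊎ (s ≡ G × localState p d x ≡ localState p d y)
  local-recv p (no p≢H) t with unmap-act ι {S p} (preserve (local p p≢H) t)
  ... | s₀ , _ , refl , ιp≡ιr₀ , t₀ with ι-injective ιp≡ιr₀
  ...   | refl = inj₁ (s₀ , refl , t₀)
  local-recv p (yes refl) t with classify MH (ι H) G (preserve gateH t)
  ... | fetch _ at-x at-y = inj₂ (refl , trans (origin-old at-x) (sym (cong origin at-y)))
  ... | take tM at-x at-y with unmap-act ι {S H} tM
  ...   | s₀ , _ , refl , ιH≡ιr₀ , t₀ with ι-injective ιH≡ιr₀
  ...     | refl = inj₁ (s₀ , refl , subst₂ (λ q q' → (q , _ , q') ∈ δ (S H))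
                                             (sym (origin-old at-x)) (sym (cong origin at-y)) t₀)

  module _ {c c' : Config C} where

    frozen-except : ∀ {r} → (∀ r' → r' ≢ r → states c' r' ≡ states c r') →
      ∀ p → ι p ≢ r → states (project c) p ≡ states (project c') p
    frozen-except fr p ιp≢r = cong (localState p (p ≟ᴾ H)) (sym (fr (ι p) ιp≢r))

    frozen-but : ∀ {p} → (∀ r' → r' ≢ ι p → states c' r' ≡ states c r') →
      states (project c) p ≡ states (project c') p → ∀ p' → states (project c) p' ≡ states (project c') p'
    frozen-but {p} fr same p' with p' ≟ᴾ p
    ... | yes refl = same
    ... | no p'≢p = frozen-except fr p' (p'≢p ∘ ι-injective)

    project-step : Step C c c' → Step S (project c) (project c') ⊎ project c ≈ project c'
    project-step (send r x a _ t refl fr ch chfr) with image r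
    ... | inj₂ r∉ι =
      inj₂ ((λ p → frozen-except fr p (r∉ι p)) , λ x y → sym (chfr _ _ λ { (ιx≡r , _) → r∉ι x ιx≡r }))
    ... | inj₁ (p , refl) with local-send p (p ≟ᴾ H) t
    ...   | inj₁ (r₀ , refl , tS) =
      inj₁ (send p r₀ a _ tS refl (λ p' p'≢p → sym (frozen-except fr p' (p'≢p ∘ ι-injective))) ch
                 (λ x y ne → chfr _ _ λ { (e₁ , e₂) → ne (ι-injective e₁ , ι-injective e₂) }))
    ...   | inj₂ (refl , same) =
      inj₂ (frozen-but fr same , λ x y → sym (chfr _ _ λ { (_ , ιy≡G) → ι≢κ y K ιy≡G }))
    project-step (recv s r a _ t refl fr ch chfr) with image r
    ... | inj₂ r∉ι =
      inj₂ ((λ p → frozen-except fr p (r∉ι p)) , λ x y → sym (chfr _ _ λ { (_ , ιy≡r) → r∉ι y ιy≡r }))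
    ... | inj₁ (p , refl) with local-recv p (p ≟ᴾ H) t
    ...   | inj₁ (s₀ , refl , tS) =
      inj₁ (recv s₀ p a _ tS refl (λ p' p'≢p → sym (frozen-except fr p' (p'≢p ∘ ι-injective))) ch
                 (λ x y ne → chfr _ _ λ { (e₁ , e₂) → ne (ι-injective e₁ , ι-injective e₂) }))
    ...   | inj₂ (refl , same) =
      inj₂ (frozen-but fr same , λ x y → sym (chfr _ _ λ { (ιx≡G , _) → ι≢κ x K ιx≡G }))

  reach-project : ∀ {c} → Reachable C c → Reachable S (project c)
  reach-project (init c at-q₀ empty) = init _ (λ p → local-initial p (p ≟ᴾ H) (at-q₀ (ι p))) (λ x y → empty _ _)
  reach-project (step ρ st) with project-step st
  ... | inj₁ st' = step (reach-project ρ) st'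
  ... | inj₂ same = Reachable-resp (reach-project ρ) same

  private
    ιH≢G : ι H ≢ G
    ιH≢G = ι≢κ H K

    avoidsH : ∀ {x l y} → (x , l , y) ∈ δ MH → src l ≢ G × dst l ≢ G
    avoidsH t with unmap ι {S H} t
    ... | act s₀ r₀ _ _ , _ , refl = ι≢κ s₀ K , ι≢κ r₀ K

    avoidsK : ∀ {x l y} → (x , l , y) ∈ δ MK → src l ≢ ι H × dst l ≢ ι H
    avoidsK t with unmap κ {M'} t
    ... | act s₀ r₀ _ _ , _ , refl = (λ e → ι≢κ H s₀ (sym e)) , (λ e → ι≢κ H r₀ (sym e))

  module GH = GatewayRole C ιH≢G gateH avoidsH
  module GK = GatewayRole C (ιH≢G ∘ sym) gateK avoidsK

  ξ : Config C → Pending MH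
  ξ c = gwInfo MH (cover gateH (states c (ι H)))

  η : Config C → Pending MK
  η c = gwInfo MK (cover gateK (states c G))

  Inv : Config C → Set
  Inv c = Balanced MH MK (ξ c) (η c) (chans c (ι H) G) (chans c G (ι H))

  module _ {c c' : Config C} where
    private
      ξ-frozen : states c' (ι H) ≡ states c (ι H) → ξ c ≡ ξ c'
      ξ-frozen e = cong (gwInfo MH ∘ cover gateH) (sym e)

      η-frozen : states c' G ≡ states c G → η c ≡ η c'
      η-frozen e = cong (gwInfo MK ∘ cover gateK) (sym e)

    -- A step of ι H or of G is a gateway step; any other step touches neither gateway.
    inv-step : Step C c c' → Inv c → Inv c'
    inv-step (send r x a _ t refl fr ch chfr) I with r ≟ᴿ ι H
    ... | yes refl =
      GH.send-by-gateway {c = c} {c'} t ch chfr (Balanced-cong refl (η-frozen (fr G (ιH≢G ∘ sym))) refl refl I)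
    ... | no r≢ιH with r ≟ᴿ G
    ...   | yes refl = balanced-swap (GK.send-by-gateway {c = c} {c'} t ch chfr
                         (balanced-swap (Balanced-cong (ξ-frozen (fr (ι H) ιH≢G)) refl refl refl I)))
    ...   | no r≢G = Balanced-cong (ξ-frozen (fr (ι H) (r≢ιH ∘ sym))) (η-frozen (fr G (r≢G ∘ sym)))
                       (sym (chfr _ _ λ { (ιH≡r , _) → r≢ιH (sym ιH≡r) }))
                       (sym (chfr _ _ λ { (G≡r , _) → r≢G (sym G≡r) })) I
    inv-step (recv s r a _ t refl fr ch chfr) I with r ≟ᴿ ι H
    ... | yes refl =
      GH.recv-by-gateway {c = c} {c'} t ch chfr (Balanced-cong refl (η-frozen (fr G (ιH≢G ∘ sym))) refl refl I)
    ... | no r≢ιH with r ≟ᴿ G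
    ...   | yes refl = balanced-swap (GK.recv-by-gateway {c = c} {c'} t ch chfr
                         (balanced-swap (Balanced-cong (ξ-frozen (fr (ι H) ιH≢G)) refl refl refl I)))
    ...   | no r≢G = Balanced-cong (ξ-frozen (fr (ι H) (r≢ιH ∘ sym))) (η-frozen (fr G (r≢G ∘ sym)))
                       (sym (chfr _ _ λ { (_ , G≡r) → r≢G (sym G≡r) }))
                       (sym (chfr _ _ λ { (_ , ιH≡r) → r≢ιH (sym ιH≡r) })) I

  inv-reach : ∀ {c} → Reachable C c → Inv c
  inv-reach (init c at-q₀ empty) =
    Balanced-cong (sym (info-initial gateH (at-q₀ (ι H)))) (sym (info-initial gateK (at-q₀ G)))
                  (sym (empty _ _)) (sym (empty _ _)) balanced-start
    where
    info-initial : ∀ {r h k} {M : CFSM R A} (gate : Cover (C r) (gw M h k)) {x} → x ≡ q₀ (C r) →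
                   gwInfo M (cover gate x) ≡ pending (q₀ M) [] []
    info-initial {M = M} gate refl = gwInfo-old M (cover-q₀ gate)
  inv-reach (step ρ st) = inv-step st (inv-reach ρ)

  stuck-local : Compatible (S H) M' → ∀ p (d : Dec (p ≡ H)) {c} → Inv c →
    Stuck (C (ι p)) (ι p) (states c (ι p)) (λ s → chans c s (ι p)) →
    Stuck (S p) p (localState p d (states c (ι p))) (λ s → chans c (ι s) (ι p))
  stuck-local compat p (yes refl) I u =
    stuck-unmap ι {S H} (gateway-stuck (Compatible-map ι κ compat) (stuck-cover gateH u) I)
  stuck-local compat p (no p≢H) I u = stuck-unmap ι {S p} (stuck-cover (local p p≢H) u)

  never-stuck : NoUnspecRecep S → Compatible (S H) M' → ∀ {c} → Reachable C c →
    ∀ p → ¬ Stuck (C (ι p)) (ι p) (states c (ι p)) (λ s → chans c s (ι p))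
  never-stuck nur compat {c} ρ p u =
    nur (project c) (reach-project ρ) (p , stuck-local compat p (p ≟ᴾ H) {c} (inv-reach ρ) u)

module Composition {m n₁ n₂ : ℕ} (S₁ : System (Fin n₁) (Fin m)) (S₂ : System (Fin n₂) (Fin m))
  (H : Fin n₁) (K : Fin n₂) where

  private
    C : System (Fin n₁ ⊎ Fin n₂) (Fin m)
    C = compose S₁ S₂ H K

    -- Once compose has decided whether a role is a gateway, it runs exactly the
    -- machines Side expects, so the covers are identities.
    left-local : ∀ p → p ≢ H → Cover (C (inj₁ p)) (mapCFSM inj₁ (S₁ p))
    left-local p p≢H with p ≟ H
    ... | yes p≡H = ⊥-elim (p≢H p≡H)
    ... | no _ = cover-id

    right-local : ∀ q → q ≢ K → Cover (C (inj₂ q)) (mapCFSM inj₂ (S₂ q))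
    right-local q q≢K with q ≟ K
    ... | yes q≡K = ⊥-elim (q≢K q≡K)
    ... | no _ = cover-id

    left-gate : Cover (C (inj₁ H)) (gw (mapCFSM inj₁ (S₁ H)) (inj₁ H) (inj₂ K))
    left-gate with H ≟ H
    ... | yes _ = cover-id
    ... | no H≢H = ⊥-elim (H≢H refl)

    right-gate : Cover (C (inj₂ K)) (gw (mapCFSM inj₂ (S₂ K)) (inj₂ K) (inj₁ H))
    right-gate with K ≟ K
    ... | yes _ = cover-id
    ... | no K≢K = ⊥-elim (K≢K refl)

    _≟ᴿ_ : DecidableEquality (Fin n₁ ⊎ Fin n₂)
    _≟ᴿ_ = ≡-dec _≟_ _≟_

    left-image : (r : Fin n₁ ⊎ Fin n₂) → (Σ (Fin n₁) λ p → r ≡ inj₁ p) ⊎ (∀ p → inj₁ p ≢ r)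
    left-image (inj₁ p) = inj₁ (p , refl)
    left-image (inj₂ q) = inj₂ λ p ()

    right-image : (r : Fin n₁ ⊎ Fin n₂) → (Σ (Fin n₂) λ q → r ≡ inj₂ q) ⊎ (∀ q → inj₂ q ≢ r)
    right-image (inj₁ p) = inj₂ λ q ()
    right-image (inj₂ q) = inj₁ (q , refl)

  module Left = Side C inj₁ inj₂ inj₁-injective (λ _ _ ()) left-image _≟_ _≟ᴿ_
                  S₁ H (S₂ K) K left-local left-gate right-gate
  module Right = Side C inj₂ inj₁ inj₂-injective (λ _ _ ()) right-image _≟_ _≟ᴿ_
                  S₂ K (S₁ H) H right-local right-gate left-gate

proposition1 : ∀ {m n₁ n₂ : ℕ} (S₁ : System (Fin n₁) (Fin m)) (S₂ : System (Fin n₂) (Fin m))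
    → IsSystem S₁ → IsSystem S₂
    → NoUnspecRecep S₁ → NoUnspecRecep S₂
    → (H : Fin n₁) (K : Fin n₂) → Compatible (S₁ H) (S₂ K)
    → NoUnspecRecep (compose S₁ S₂ H K)
proposition1 S₁ S₂ _ _ nur₁ nur₂ H K compat c ρ (inj₁ p , stuck) =
  Composition.Left.never-stuck S₁ S₂ H K nur₁ compat ρ p stuck
proposition1 S₁ S₂ _ _ nur₁ nur₂ H K compat c ρ (inj₂ q , stuck) =
  Composition.Right.never-stuck S₁ S₂ H K nur₂ (Compatible-sym compat) ρ q stuck
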